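{- Let $2\le k\le n$ and let $\mathcal{F}=\mathcal{A}\cup\mathcal{B}$ be a full squashed flat antichain with $\mathcal{A}\subseteq\binom{[n]}{k}$ and $\mathcal{B}\subseteq\binom{[n]}{k-1}$. Then $\mathcal{F}$ is contained in a unique maximal squashed flat antichain $\mathcal{F}'\subseteq\binom{[n]}{k}\cup\binom{[n]}{k-1}$, and $\mathcal{F}'$ is of the form $\mathcal{A}'\cup\mathcal{B}$ with $\mathcal{A}\subseteq\mathcal{A}'\subseteq\binom{[n]}{k}$.
   Context: $[n]=\{1,\dots,n\}$, $\binom{[n]}{i}$ is the family of $i$-subsets of $[n]$. Squashed (colexicographic) order: for distinct $F,G\subseteq[n]$, $F<_S G$ iff $\max\bigl((F\cup G)\setminus(F\cap G)\bigr)\in G$. For $\mathcal{G}\subseteq\binom{[n]}{i}$, the shadow is $\Delta\mathcal{G}=\{H\in\binom{[n]}{i-1}: H\subset G \text{ for some } G\in\mathcal{G}\}$ and the shade is $\nabla\mathcal{G}=\{H\in\binom{[n]}{i+1}: H\supset G\text{ for some }G\in\mathcal{G}\}$. A full squashed flat antichain (FSFA) is a family $\mathcal{A}\cup\mathcal{B}$ where, for some $1\le k\le n$ and $0\le m\le\binom nk$, $\mathcal{A}$ is the set of the first $m$ elements of $\binom{[n]}{k}$ in squashed order and $\mathcal{B}=\binom{[n]}{k-1}\setminus\Delta\mathcal{A}$. It is a maximal squashed flat antichain (MSFA) if additionally $\mathcal{A}=\binom{[n]}{k}\setminus\nabla\mathcal{B}$. -}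

module Defs where

open import Level using (0ℓ)
open import Data.Nat using (ℕ; suc; _≤_; _<_; _∸_)
open import Data.Nat.Combinatorics using (_C_)
open import Data.Fin using (Fin) renaming (_<_ to _<ᶠ_)
open import Data.Fin.Subset using (Subset; ∣_∣) renaming (_∈_ to _∈ₛ_; _∉_ to _∉ₛ_; _⊂_ to _⊂ₛ_)
open import Data.List using (List; length)
open import Data.List.Membership.Propositional using () renaming (_∈_ to _∈ₗ_)
open import Data.List.Relation.Unary.Unique.Propositional using (Unique)
open import Data.Product using (Σ; ∃; _×_)
open import Function.Bundles using (_⇔_)
open import Relation.Nullary using (¬_)
open import Relation.Binary.PropositionalEquality using (_≡_)
open import Relation.Unary using (Pred)

-- A family of subsets of [n]  (subsets of [n] = Data.Fin.Subset n, element i+1 ↔ Fin index i)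
Fam : ℕ → Set₁
Fam n = Pred (Subset n) 0ℓ

Level : (n i : ℕ) → Fam n
Level n i F = ∣ F ∣ ≡ i

-- Squashed (colex) order:  F <S G  iff  max (F △ G) ∈ G, i.e. there is an
-- element x ∈ G \ F such that every larger element lies in both or neither.
_<S_ : ∀ {n} → Subset n → Subset n → Set
F <S G = ∃ λ x → x ∈ₛ G × x ∉ₛ F × (∀ y → x <ᶠ y → (y ∈ₛ F ⇔ y ∈ₛ G))

Shadow : ∀ {n} (i : ℕ) → Fam n → Fam n
Shadow i 𝒢 H = ∣ H ∣ ≡ i ∸ 1 × ∃ λ G → 𝒢 G × H ⊂ₛ G

Shade : ∀ {n} (i : ℕ) → Fam n → Fam n
Shade i 𝒢 H = ∣ H ∣ ≡ suc i × ∃ λ G → 𝒢 G × G ⊂ₛ H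

-- 𝒜 is the set of the first m elements of binom([n], k) in squashed order:
-- 𝒜 is exactly the set of entries of a duplicate-free list of m k-sets which
-- contains every k-set preceding (in squashed order) any of its entries.
FirstInSquashed : (n k m : ℕ) → Fam n → Set
FirstInSquashed n k m 𝒜 =
  Σ (List (Subset n)) λ L →
    Unique L × length L ≡ m
    × (∀ F → F ∈ₗ L → ∣ F ∣ ≡ k)
    × (∀ F G → F ∈ₗ L → ∣ G ∣ ≡ k → G <S F → G ∈ₗ L)
    × (∀ F → (𝒜 F ⇔ F ∈ₗ L))

FSFA : (n k m : ℕ) → Fam n → Fam n → Set
FSFA n k m 𝒜 ℬ =
  1 ≤ k × k ≤ n × m ≤ n C k
  × FirstInSquashed n k m 𝒜
  × (∀ H → (ℬ H ⇔ (∣ H ∣ ≡ k ∸ 1 × ¬ Shadow k 𝒜 H)))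

MSFA : (n k m : ℕ) → Fam n → Fam n → Set
MSFA n k m 𝒜 ℬ =
  FSFA n k m 𝒜 ℬ × (∀ F → (𝒜 F ⇔ (∣ F ∣ ≡ k × ¬ Shade (k ∸ 1) ℬ F)))

-- The shadow of an initial segment of the squashed order is again an initial segment (Kruskal–Katona);
-- dually, the family of k-sets outside the shade of a final segment of (k−1)-sets is initial. Hence
-- 𝒜′ := binom([n],k) ∖ ∇ℬ is initial, contains 𝒜, and its shadow complement is still ℬ, so 𝒜′ ∪ ℬ is
-- maximal. Any maximal flat antichain 𝒜″ ∪ ℬ″ containing 𝒜 ∪ ℬ within the two levels has ℬ″ ⊇ ℬ and
-- 𝒜″ ⊇ 𝒜, hence ℬ″ = ℬ and 𝒜″ = 𝒜′; the only other possibilities are levels k ± 1, where the union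
-- degenerates to a full level and agrees with 𝒜′ ∪ ℬ as a family.
module Submission where

open import Defs
open import Data.Bool using (Bool)
import Data.Bool as Bool
open import Data.Empty using (⊥-elim)
open import Data.Fin using (Fin; zero; suc) renaming (_<_ to _<ᶠ_)
open import Data.Fin.Subset using (Subset; inside; outside; ∣_∣; _∈_; _∉_; _⊂_) renaming (_⊆_ to _⊆ₛ_)
open import Data.Fin.Subset.Properties using (drop-there; drop-∷-⊆; ⊆-antisym; p⊆q⇒∣p∣≤∣q∣; anySubset?; _⊂?_)
open import Data.List using (List; []; _∷_; map; _++_; length; filter)
open import Data.List.Properties using (length-map; length-++; length-filter)
open import Data.List.Membership.Propositional using () renaming (_∈_ to _∈ₗ_)
open import Data.List.Membership.Propositional.Properties using (∈-map⁺; ∈-map⁻; ∈-++⁺ˡ; ∈-++⁺ʳ; ∈-filter⁺; ∈-filter⁻)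
import Data.List.Membership.DecPropositional as DecMembership
open import Data.List.Relation.Unary.Any using (here)
open import Data.List.Relation.Unary.All using ([])
open import Data.List.Relation.Unary.AllPairs using ([]; _∷_)
open import Data.List.Relation.Unary.Unique.Propositional using (Unique)
import Data.List.Relation.Unary.Unique.Propositional.Properties as Unique
open import Data.Nat using (ℕ; zero; suc; _+_; _∸_; _≤_; _<_; z≤n; s≤s; _≟_)
open import Data.Nat.Properties using (suc-injective; 1+n≢n; 1+n≰n; <⇒≢; <⇒≤; n<1+n; m<n⇒m<1+n; ≤-trans; ≤-reflexive; +-comm)
open import Data.Nat.Combinatorics using (_C_; nCk+nC[k+1]≡[n+1]C[k+1])
open import Data.Product using (Σ; ∃; _×_; _,_; proj₁; proj₂)
open import Data.Sum using (_⊎_; inj₁; inj₂; [_,_]′)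
import Data.Sum as Sum
open import Data.Vec using ([]; _∷_)
open import Data.Vec.Base using (here; there)
open import Data.Vec.Properties using (≡-dec; ∷-injectiveʳ)
open import Function using (_∘_; id)
open import Function.Bundles using (_⇔_; mk⇔; Equivalence)
open import Function.Properties.Equivalence using () renaming (refl to ⇔-refl)
open import Relation.Binary.Construct.Closure.Reflexive using (ReflClosure; refl; [_])
open import Relation.Binary.PropositionalEquality using (_≡_; _≢_; refl; sym; trans; cong; cong₂; subst; module ≡-Reasoning)
open import Relation.Nullary using (¬_; ¬?; _×-dec_; _⊎-dec_; contradiction)
open import Relation.Nullary.Decidable using (map′; decidable-stable)
open import Relation.Unary using (Decidable; Empty; Satisfiable; _⊆_; _∪_; _≐_)
open Equivalence

private variable
  n k j : ℕ
  p q r W X Y Z : Subset n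
  𝒜 ℬ 𝒜″ ℬ″ : Fam n

-- Colex order. A subset is a vector of membership bits whose head is the smallest element,
-- so the comparison is decided by the tails first.
data _≺_ : Subset n → Subset n → Set where
  ≺-here  : (outside ∷ p) ≺ (inside ∷ p)
  ≺-there : ∀ {a b : Bool} → p ≺ q → (a ∷ p) ≺ (b ∷ q)

_≼_ : Subset n → Subset n → Set
_≼_ = ReflClosure _≺_

data _⋖_ : Subset n → Subset n → Set where
  ⋖-here  : (outside ∷ p) ⋖ (inside ∷ p)
  ⋖-there : ∀ {b : Bool} → p ⋖ q → (b ∷ p) ⋖ (b ∷ q)

≺-trans : p ≺ q → q ≺ r → p ≺ r
≺-trans ≺-here        (≺-there q≺r) = ≺-there q≺r
≺-trans (≺-there p≺q) ≺-here        = ≺-there p≺q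
≺-trans (≺-there p≺q) (≺-there q≺r) = ≺-there (≺-trans p≺q q≺r)

≼-≺-trans : p ≼ q → q ≺ r → p ≺ r
≼-≺-trans refl    q≺r = q≺r
≼-≺-trans [ p≺q ] q≺r = ≺-trans p≺q q≺r

≺-≼-trans : p ≺ q → q ≼ r → p ≺ r
≺-≼-trans p≺q refl    = p≺q
≺-≼-trans p≺q [ q≺r ] = ≺-trans p≺q q≺r

∷-mono-≼ : ∀ {b : Bool} → p ≼ q → (b ∷ p) ≼ (b ∷ q)
∷-mono-≼ refl    = refl
∷-mono-≼ [ p≺q ] = [ ≺-there p≺q ]

⋖⇒≺ : p ⋖ q → p ≺ q
⋖⇒≺ ⋖-here       = ≺-here
⋖⇒≺ (⋖-there p⋖q) = ≺-there (⋖⇒≺ p⋖q)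

⋖-size : p ⋖ q → ∣ q ∣ ≡ suc ∣ p ∣
⋖-size ⋖-here                     = refl
⋖-size (⋖-there {b = inside} p⋖q)  = cong suc (⋖-size p⋖q)
⋖-size (⋖-there {b = outside} p⋖q) = ⋖-size p⋖q


≺-coverBelow : Y ≺ X → ∣ Y ∣ < ∣ X ∣ → ∃ λ W → Y ⋖ W × W ≼ X
≺-coverBelow ≺-here _ = _ , ⋖-here , refl
≺-coverBelow (≺-there {a = outside} Y≺X) _ = _ , ⋖-here , [ ≺-there Y≺X ]
≺-coverBelow (≺-there {a = inside} {b = inside} Y≺X) (s≤s h) with ≺-coverBelow Y≺X h
... | W , Y⋖W , W≼X = inside ∷ W , ⋖-there Y⋖W , ∷-mono-≼ W≼X
≺-coverBelow (≺-there {a = inside} {b = outside} Y≺X) h with ≺-coverBelow Y≺X (<⇒≤ h)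
... | W , Y⋖W , refl    = contradiction (≤-trans h (≤-reflexive (⋖-size Y⋖W))) 1+n≰n
... | W , Y⋖W , [ W≺X ] = inside ∷ W , ⋖-there Y⋖W , [ ≺-there W≺X ]

≺-cocoverAbove : Y ≺ X → ∣ Y ∣ < ∣ X ∣ → ∃ λ Z → Z ⋖ X × Y ≼ Z
≺-cocoverAbove ≺-here _ = _ , ⋖-here , refl
≺-cocoverAbove (≺-there {b = inside} Y≺X) _ = _ , ⋖-here , [ ≺-there Y≺X ]
≺-cocoverAbove (≺-there {a = outside} {b = outside} Y≺X) h with ≺-cocoverAbove Y≺X h
... | Z , Z⋖X , Y≼Z = outside ∷ Z , ⋖-there Z⋖X , ∷-mono-≼ Y≼Z
≺-cocoverAbove (≺-there {a = inside} {b = outside} Y≺X) h with ≺-cocoverAbove Y≺X (<⇒≤ h)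
... | Z , Z⋖X , refl    = contradiction (≤-trans h (≤-reflexive (⋖-size Z⋖X))) 1+n≰n
... | Z , Z⋖X , [ Y≺Z ] = outside ∷ Z , ⋖-there Z⋖X , [ ≺-there Y≺Z ]

-- The exchange step behind "the shadow of an initial segment is initial".
≺-⋖-lift : Y ≺ Z → ∣ Y ∣ ≡ ∣ Z ∣ → Z ⋖ X → ∃ λ W → Y ⋖ W × W ≼ X
≺-⋖-lift (≺-there {a = outside} Y≺Z) _ ⋖-here = _ , ⋖-here , [ ≺-there Y≺Z ]
≺-⋖-lift (≺-there {a = inside} Y≺Z) e ⋖-here with ≺-coverBelow Y≺Z (≤-reflexive e)
... | W , Y⋖W , W≼Z = inside ∷ W , ⋖-there Y⋖W , ∷-mono-≼ W≼Z
≺-⋖-lift ≺-here _ (⋖-there Y⋖X) = _ , ⋖-there Y⋖X , [ ≺-here ]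
≺-⋖-lift (≺-there {a = inside} Y≺Z) e (⋖-there {b = inside} Z⋖X) with ≺-⋖-lift Y≺Z (suc-injective e) Z⋖X
... | W , Y⋖W , W≼X = inside ∷ W , ⋖-there Y⋖W , ∷-mono-≼ W≼X
≺-⋖-lift (≺-there {a = outside} Y≺Z) e (⋖-there {b = outside} Z⋖X) with ≺-⋖-lift Y≺Z e Z⋖X
... | W , Y⋖W , W≼X = outside ∷ W , ⋖-there Y⋖W , ∷-mono-≼ W≼X
≺-⋖-lift (≺-there {a = outside} Y≺Z) _ (⋖-there {b = inside} Z⋖X) =
  _ , ⋖-here , [ ≺-there (≺-trans Y≺Z (⋖⇒≺ Z⋖X)) ]
≺-⋖-lift (≺-there {a = inside} Y≺Z) e (⋖-there {b = outside} Z⋖X) with ≺-coverBelow Y≺Z (≤-reflexive e)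
... | W , Y⋖W , W≼Z = inside ∷ W , ⋖-there Y⋖W , [ ≺-there (≼-≺-trans W≼Z (⋖⇒≺ Z⋖X)) ]

-- The exchange step behind "the shade complement of a final segment is initial".
⋖-≺-lower : Y ⋖ W → W ≺ X → ∣ W ∣ ≡ ∣ X ∣ → ∃ λ Z → Z ⋖ X × Y ≼ Z
⋖-≺-lower (⋖-there Y⋖W) ≺-here _ = _ , ⋖-here , [ ≺-there (⋖⇒≺ Y⋖W) ]
⋖-≺-lower ⋖-here (≺-there {b = inside} W≺X) _ = _ , ⋖-here , [ ≺-there W≺X ]
⋖-≺-lower ⋖-here (≺-there {b = outside} W≺X) e with ≺-cocoverAbove W≺X (≤-reflexive e)
... | Z , Z⋖X , W≼Z = outside ∷ Z , ⋖-there Z⋖X , ∷-mono-≼ W≼Z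
⋖-≺-lower (⋖-there Y⋖W) (≺-there {a = inside} {b = inside} W≺X) e with ⋖-≺-lower Y⋖W W≺X (suc-injective e)
... | Z , Z⋖X , Y≼Z = inside ∷ Z , ⋖-there Z⋖X , ∷-mono-≼ Y≼Z
⋖-≺-lower (⋖-there Y⋖W) (≺-there {a = outside} {b = outside} W≺X) e with ⋖-≺-lower Y⋖W W≺X e
... | Z , Z⋖X , Y≼Z = outside ∷ Z , ⋖-there Z⋖X , ∷-mono-≼ Y≼Z
⋖-≺-lower (⋖-there Y⋖W) (≺-there {a = inside} {b = outside} W≺X) e with ≺-cocoverAbove W≺X (≤-reflexive e)
... | Z , Z⋖X , W≼Z = outside ∷ Z , ⋖-there Z⋖X , [ ≺-there (≺-≼-trans (⋖⇒≺ Y⋖W) W≼Z) ]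
⋖-≺-lower (⋖-there Y⋖W) (≺-there {a = outside} {b = inside} W≺X) _ =
  _ , ⋖-here , [ ≺-there (≺-trans (⋖⇒≺ Y⋖W) W≺X) ]

drop-⇔ : ∀ {a b : Bool} {x} → (suc x ∈ a ∷ p ⇔ suc x ∈ b ∷ q) → (x ∈ p ⇔ x ∈ q)
drop-⇔ e = mk⇔ (drop-there ∘ to e ∘ there) (drop-there ∘ from e ∘ there)

≺⇒<S : p ≺ q → p <S q
≺⇒<S ≺-here = zero , here , (λ ()) , λ where
  (suc y) _ → mk⇔ (there ∘ drop-there) (there ∘ drop-there)
≺⇒<S (≺-there p≺q) with ≺⇒<S p≺q
... | x , x∈q , x∉p , above = suc x , there x∈q , x∉p ∘ drop-there , λ where
  (suc y) (s≤s x<y) → mk⇔ (there ∘ to (above y x<y) ∘ drop-there) (there ∘ from (above y x<y) ∘ drop-there)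

≡-above-zero : ∀ {a b : Bool} {p q : Subset n} → (∀ (y : Fin (suc n)) → zero {n} <ᶠ y → (y ∈ a ∷ p ⇔ y ∈ b ∷ q)) → p ≡ q
≡-above-zero {p = p} {q = q} above = ⊆-antisym (to (tail _)) (from (tail _))
  where
    tail : ∀ y → y ∈ p ⇔ y ∈ q
    tail y = drop-⇔ (above (suc y) (s≤s z≤n))

<S⇒≺ : p <S q → p ≺ q
<S⇒≺ {p = inside ∷ p} (zero , here , 0∉p , _) = contradiction here 0∉p
<S⇒≺ {p = outside ∷ p} {q = inside ∷ q} (zero , here , _ , above) with ≡-above-zero above
... | refl = ≺-here
<S⇒≺ {p = _ ∷ _} {q = _ ∷ _} (suc x , there x∈q , x∉p , above) =
  ≺-there (<S⇒≺ (x , x∈q , x∉p ∘ there , λ y x<y → drop-⇔ (above (suc y) (s≤s x<y))))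

⋖⇒⊂ : p ⋖ q → p ⊂ q
⋖⇒⊂ p⋖q = ⋖⇒⊆ p⋖q , added p⋖q
  where
    ⋖⇒⊆ : p ⋖ q → p ⊆ₛ q
    ⋖⇒⊆ ⋖-here        (there x∈p) = there x∈p
    ⋖⇒⊆ (⋖-there _)   here        = here
    ⋖⇒⊆ (⋖-there p⋖q) (there x∈p) = there (⋖⇒⊆ p⋖q x∈p)
    added : p ⋖ q → ∃ λ x → x ∈ q × x ∉ p
    added ⋖-here = zero , here , λ ()
    added (⋖-there p⋖q) with added p⋖q
    ... | x , x∈q , x∉p = suc x , there x∈q , x∉p ∘ drop-there

p⊆q∧∣p∣≡∣q∣⇒p≡q : p ⊆ₛ q → ∣ p ∣ ≡ ∣ q ∣ → p ≡ q
p⊆q∧∣p∣≡∣q∣⇒p≡q {p = []}          {[]}          _ _ = refl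
p⊆q∧∣p∣≡∣q∣⇒p≡q {p = inside ∷ p}  {inside ∷ q}  s e =
  cong (inside ∷_) (p⊆q∧∣p∣≡∣q∣⇒p≡q (drop-∷-⊆ s) (suc-injective e))
p⊆q∧∣p∣≡∣q∣⇒p≡q {p = outside ∷ p} {outside ∷ q} s e = cong (outside ∷_) (p⊆q∧∣p∣≡∣q∣⇒p≡q (drop-∷-⊆ s) e)
p⊆q∧∣p∣≡∣q∣⇒p≡q {p = inside ∷ p}  {outside ∷ q} s e = contradiction (s here) λ ()
p⊆q∧∣p∣≡∣q∣⇒p≡q {p = outside ∷ p} {inside ∷ q}  s e =
  contradiction (subst (_≤ ∣ q ∣) e (p⊆q⇒∣p∣≤∣q∣ (drop-∷-⊆ s))) 1+n≰n

⊆⇒⋖ : p ⊆ₛ q → suc ∣ p ∣ ≡ ∣ q ∣ → p ⋖ q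
⊆⇒⋖ {p = inside ∷ p}  {inside ∷ q}  s e = ⋖-there (⊆⇒⋖ (drop-∷-⊆ s) (suc-injective e))
⊆⇒⋖ {p = outside ∷ p} {outside ∷ q} s e = ⋖-there (⊆⇒⋖ (drop-∷-⊆ s) e)
⊆⇒⋖ {p = inside ∷ p}  {outside ∷ q} s e = contradiction (s here) λ ()
⊆⇒⋖ {p = outside ∷ p} {inside ∷ q}  s e with p⊆q∧∣p∣≡∣q∣⇒p≡q (drop-∷-⊆ s) (suc-injective e)
... | refl = ⋖-here

∃-⋖ : ∣ q ∣ ≡ suc j → ∃ λ p → p ⋖ q
∃-⋖ {q = inside ∷ q}  _ = outside ∷ q , ⋖-here
∃-⋖ {q = outside ∷ q} e with ∃-⋖ e
... | p , p⋖q = outside ∷ p , ⋖-there p⋖q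

Level-satisfiable : j ≤ n → Satisfiable (Level n j)
Level-satisfiable {zero}  {zero}  _ = [] , refl
Level-satisfiable {zero}  {suc n} _ with Level-satisfiable {zero} {n} z≤n
... | p , ∣p∣≡0 = outside ∷ p , ∣p∣≡0
Level-satisfiable {suc j} {suc n} (s≤s j≤n) with Level-satisfiable j≤n
... | p , ∣p∣≡j = inside ∷ p , cong suc ∣p∣≡j

combinations : (n k : ℕ) → List (Subset n)
combinations zero    zero    = [] ∷ []
combinations zero    (suc k) = []
combinations (suc n) zero    = map (outside ∷_) (combinations n zero)
combinations (suc n) (suc k) = map (outside ∷_) (combinations n (suc k)) ++ map (inside ∷_) (combinations n k)

length-combinations : ∀ n k → length (combinations n k) ≡ n C k
length-combinations zero    zero    = refl
length-combinations zero    (suc k) = refl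
length-combinations (suc n) zero    = trans (length-map _ (combinations n zero)) (length-combinations n zero)
length-combinations (suc n) (suc k) = begin
  length (map (outside ∷_) (combinations n (suc k)) ++ map (inside ∷_) (combinations n k))
    ≡⟨ length-++ (map (outside ∷_) (combinations n (suc k))) ⟩
  length (map (outside ∷_) (combinations n (suc k))) + length (map (inside ∷_) (combinations n k))
    ≡⟨ cong₂ _+_ (length-map _ (combinations n (suc k))) (length-map _ (combinations n k)) ⟩
  length (combinations n (suc k)) + length (combinations n k)
    ≡⟨ cong₂ _+_ (length-combinations n (suc k)) (length-combinations n k) ⟩
  n C suc k + n C k
    ≡⟨ +-comm (n C suc k) (n C k) ⟩
  n C k + n C suc k
    ≡⟨ nCk+nC[k+1]≡[n+1]C[k+1] n k ⟩
  suc n C suc k ∎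
  where open ≡-Reasoning

∈-combinations : ∣ p ∣ ≡ k → p ∈ₗ combinations n k
∈-combinations {p = []}          {k = zero}  _ = here refl
∈-combinations {p = outside ∷ p} {k = zero}  e = ∈-map⁺ (outside ∷_) (∈-combinations e)
∈-combinations {p = outside ∷ p} {k = suc k} e = ∈-++⁺ˡ (∈-map⁺ (outside ∷_) (∈-combinations e))
∈-combinations {n = suc n} {p = inside ∷ p} {k = suc k} e =
  ∈-++⁺ʳ (map (outside ∷_) (combinations n (suc k))) (∈-map⁺ (inside ∷_) (∈-combinations (suc-injective e)))

combinations-unique : ∀ n k → Unique (combinations n k)
combinations-unique zero    zero    = [] ∷ []
combinations-unique zero    (suc k) = []
combinations-unique (suc n) zero    = Unique.map⁺ ∷-injectiveʳ (combinations-unique n zero)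
combinations-unique (suc n) (suc k) =
  Unique.++⁺ (Unique.map⁺ ∷-injectiveʳ (combinations-unique n (suc k)))
             (Unique.map⁺ ∷-injectiveʳ (combinations-unique n k))
             disjoint
  where
    disjoint : ¬ (p ∈ₗ map (outside ∷_) (combinations n (suc k)) × p ∈ₗ map (inside ∷_) (combinations n k))
    disjoint (p∈ , p∈′) with ∈-map⁻ (outside ∷_) p∈ | ∈-map⁻ (inside ∷_) p∈′
    ... | _ , _ , refl | _ , _ , ()

ShadowComplement : ℕ → Fam n → Fam n → Set
ShadowComplement k 𝒜 ℬ = ∀ H → ℬ H ⇔ (∣ H ∣ ≡ k ∸ 1 × ¬ Shadow k 𝒜 H)

shadeComplement : ℕ → Fam n → Fam n
shadeComplement k ℬ F = ∣ F ∣ ≡ k × ¬ Shade (k ∸ 1) ℬ F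

DownClosed : ℕ → Fam n → Set
DownClosed k 𝒜 = ∀ {F G} → 𝒜 F → ∣ G ∣ ≡ k → G ≺ F → 𝒜 G

UpClosed : ℕ → Fam n → Set
UpClosed k ℬ = ∀ {Y Z} → ℬ Y → ∣ Z ∣ ≡ k → Y ≺ Z → ℬ Z

downClosed-≼ : DownClosed k 𝒜 → 𝒜 X → ∣ Y ∣ ≡ k → Y ≼ X → 𝒜 Y
downClosed-≼ _    a _   refl    = a
downClosed-≼ 𝒜-dc a ∣Y∣ [ Y≺X ] = 𝒜-dc a ∣Y∣ Y≺X

upClosed-≼ : UpClosed k ℬ → ℬ X → ∣ Y ∣ ≡ k → X ≼ Y → ℬ Y
upClosed-≼ _    b _   refl    = b
upClosed-≼ ℬ-uc b ∣Y∣ [ X≺Y ] = ℬ-uc b ∣Y∣ X≺Y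

Shadow-mono : 𝒜 ⊆ 𝒜″ → Shadow k 𝒜 ⊆ Shadow k 𝒜″
Shadow-mono 𝒜⊆𝒜″ (∣H∣ , G , a , H⊂G) = ∣H∣ , G , 𝒜⊆𝒜″ a , H⊂G

Shade-mono : ℬ ⊆ ℬ″ → Shade k ℬ ⊆ Shade k ℬ″
Shade-mono ℬ⊆ℬ″ (∣H∣ , G , b , G⊂H) = ∣H∣ , G , ℬ⊆ℬ″ b , G⊂H

shadeComplement-antitone : ℬ ⊆ ℬ″ → shadeComplement k ℬ″ ⊆ shadeComplement k ℬ
shadeComplement-antitone ℬ⊆ℬ″ (∣F∣ , ∉∇ℬ″) = ∣F∣ , ∉∇ℬ″ ∘ Shade-mono ℬ⊆ℬ″

shadow-downClosed : 𝒜 ⊆ Level n (suc k) → DownClosed (suc k) 𝒜 → DownClosed k (Shadow (suc k) 𝒜)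
shadow-downClosed 𝒜-level 𝒜-dc (∣Z∣ , A , a , Z⊂A) ∣Y∣ Y≺Z
  with ≺-⋖-lift Y≺Z (trans ∣Y∣ (sym ∣Z∣)) (⊆⇒⋖ (proj₁ Z⊂A) (trans (cong suc ∣Z∣) (sym (𝒜-level a))))
... | A′ , Y⋖A′ , A′≼A =
  ∣Y∣ , A′ , downClosed-≼ 𝒜-dc a (trans (⋖-size Y⋖A′) (cong suc ∣Y∣)) A′≼A , ⋖⇒⊂ Y⋖A′

shadowComplement-upClosed : ShadowComplement (suc k) 𝒜 ℬ → DownClosed k (Shadow (suc k) 𝒜) → UpClosed k ℬ
shadowComplement-upClosed ℬ-def ∂𝒜-dc {Y} {Z} b ∣Z∣ Y≺Z with to (ℬ-def Y) b
... | ∣Y∣ , Y∉∂𝒜 = from (ℬ-def Z) (∣Z∣ , λ Z∈∂𝒜 → Y∉∂𝒜 (∂𝒜-dc Z∈∂𝒜 ∣Y∣ Y≺Z))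

shadeComplement-downClosed : ℬ ⊆ Level n k → UpClosed k ℬ → DownClosed (suc k) (shadeComplement (suc k) ℬ)
shadeComplement-downClosed {ℬ = ℬ} {k = k} ℬ-level ℬ-uc {F} {G} (∣F∣ , F∉∇ℬ) ∣G∣ G≺F = ∣G∣ , G∉∇ℬ
  where
    G∉∇ℬ : ¬ Shade k ℬ G
    G∉∇ℬ (_ , Y , b , Y⊂G)
      with ⋖-≺-lower (⊆⇒⋖ (proj₁ Y⊂G) (trans (cong suc (ℬ-level b)) (sym ∣G∣))) G≺F (trans ∣G∣ (sym ∣F∣))
    ... | Z , Z⋖F , Y≼Z =
      F∉∇ℬ (∣F∣ , Z , upClosed-≼ ℬ-uc b (suc-injective (trans (sym (⋖-size Z⋖F)) ∣F∣)) Y≼Z , ⋖⇒⊂ Z⋖F)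

⊆-shadeComplement : 𝒜 ⊆ Level n (suc k) → ShadowComplement (suc k) 𝒜 ℬ → 𝒜 ⊆ shadeComplement (suc k) ℬ
⊆-shadeComplement 𝒜-level ℬ-def {A} a = 𝒜-level a , λ (_ , Y , b , Y⊂A) →
  proj₂ (to (ℬ-def Y) b) (proj₁ (to (ℬ-def Y) b) , A , a , Y⊂A)

shadowComplement-shadeComplement : 𝒜 ⊆ shadeComplement (suc k) ℬ → ShadowComplement (suc k) 𝒜 ℬ →
  ShadowComplement (suc k) (shadeComplement (suc k) ℬ) ℬ
shadowComplement-shadeComplement 𝒜⊆𝒜′ ℬ-def H = mk⇔
  (λ b → proj₁ (to (ℬ-def H) b) , λ (_ , G , (∣G∣ , G∉∇ℬ) , H⊂G) → G∉∇ℬ (∣G∣ , H , b , H⊂G))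
  (λ (∣H∣ , H∉∂𝒜′) → from (ℬ-def H) (∣H∣ , H∉∂𝒜′ ∘ Shadow-mono {k = suc _} 𝒜⊆𝒜′))

Shadow-dec : Decidable 𝒜 → Decidable (Shadow k 𝒜)
Shadow-dec {k = k} 𝒜? H = (∣ H ∣ ≟ k ∸ 1) ×-dec anySubset? (λ G → 𝒜? G ×-dec (H ⊂? G))

Shade-dec : Decidable ℬ → Decidable (Shade k ℬ)
Shade-dec {k = k} ℬ? F = (∣ F ∣ ≟ suc k) ×-dec anySubset? (λ G → ℬ? G ×-dec (G ⊂? F))

shadowComplement-dec : Decidable 𝒜 → ShadowComplement k 𝒜 ℬ → Decidable ℬ
shadowComplement-dec {k = k} 𝒜? ℬ-def H =
  map′ (from (ℬ-def H)) (to (ℬ-def H)) ((∣ H ∣ ≟ k ∸ 1) ×-dec ¬? (Shadow-dec {k = k} 𝒜? H))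

shadeComplement-dec : Decidable ℬ → Decidable (shadeComplement k ℬ)
shadeComplement-dec {k = k} ℬ? F = (∣ F ∣ ≟ k) ×-dec ¬? (Shade-dec ℬ? F)

firstInSquashed-level : FirstInSquashed n k j 𝒜 → 𝒜 ⊆ Level n k
firstInSquashed-level (_ , _ , _ , ∈L⇒level , _ , ∈L⇔) {F} a = ∈L⇒level F (to (∈L⇔ F) a)

firstInSquashed-downClosed : FirstInSquashed n k j 𝒜 → DownClosed k 𝒜
firstInSquashed-downClosed (_ , _ , _ , _ , L-closed , ∈L⇔) {F} {G} a ∣G∣ G≺F =
  from (∈L⇔ G) (L-closed F G (to (∈L⇔ F) a) ∣G∣ (≺⇒<S G≺F))

firstInSquashed-dec : FirstInSquashed n k j 𝒜 → Decidable 𝒜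
firstInSquashed-dec (L , _ , _ , _ , _ , ∈L⇔) F =
  map′ (from (∈L⇔ F)) (to (∈L⇔ F)) (DecMembership._∈?_ (≡-dec Bool._≟_) F L)

downClosed⇒firstInSquashed : Decidable 𝒜 → 𝒜 ⊆ Level n k → DownClosed k 𝒜 →
  ∃ λ m → m ≤ n C k × FirstInSquashed n k m 𝒜
downClosed⇒firstInSquashed {n = n} {𝒜 = 𝒜} {k = k} 𝒜? 𝒜-level 𝒜-dc =
  length L , length≤ , L , Unique.filter⁺ 𝒜? (combinations-unique n k) , refl
  , (λ F F∈L → 𝒜-level (∈L⇒𝒜 F∈L))
  , (λ F G F∈L ∣G∣ G<F → 𝒜⇒∈L (𝒜-dc (∈L⇒𝒜 F∈L) ∣G∣ (<S⇒≺ G<F)))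
  , λ F → mk⇔ 𝒜⇒∈L ∈L⇒𝒜
  where
    L : List (Subset n)
    L = filter 𝒜? (combinations n k)
    ∈L⇒𝒜 : ∀ {F} → F ∈ₗ L → 𝒜 F
    ∈L⇒𝒜 = proj₂ ∘ ∈-filter⁻ 𝒜? {xs = combinations n k}
    𝒜⇒∈L : ∀ {F} → 𝒜 F → F ∈ₗ L
    𝒜⇒∈L a = ∈-filter⁺ 𝒜? (∈-combinations (𝒜-level a)) a
    length≤ : length L ≤ n C k
    length≤ = ≤-trans (length-filter 𝒜? (combinations n k)) (≤-reflexive (length-combinations n k))

shadeComplement-MSFA : FSFA n (suc k) j 𝒜 ℬ → ∃ λ m → MSFA n (suc k) m (shadeComplement (suc k) ℬ) ℬ
shadeComplement-MSFA {n = n} {k = k} {𝒜 = 𝒜} {ℬ = ℬ} (1≤k , k≤n , _ , first , ℬ-def) =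
  let (m , m≤nCk , first′) = downClosed⇒firstInSquashed 𝒜′? proj₁ 𝒜′-downClosed
  in  m , (1≤k , k≤n , m≤nCk , first′ , shadowComplement-shadeComplement 𝒜⊆𝒜′ ℬ-def) , λ _ → ⇔-refl
  where
    𝒜-level : 𝒜 ⊆ Level n (suc k)
    𝒜-level = firstInSquashed-level first
    𝒜⊆𝒜′ : 𝒜 ⊆ shadeComplement (suc k) ℬ
    𝒜⊆𝒜′ = ⊆-shadeComplement 𝒜-level ℬ-def
    𝒜′? : Decidable (shadeComplement (suc k) ℬ)
    𝒜′? = shadeComplement-dec (shadowComplement-dec {k = suc k} (firstInSquashed-dec first) ℬ-def)
    𝒜′-downClosed : DownClosed (suc k) (shadeComplement (suc k) ℬ)
    𝒜′-downClosed = shadeComplement-downClosed (proj₁ ∘ to (ℬ-def _))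
      (shadowComplement-upClosed ℬ-def (shadow-downClosed 𝒜-level (firstInSquashed-downClosed first)))

level-clash : ∀ {s} → j ≢ k → s ≡ j → s ≢ k
level-clash j≢k s≡j s≡k = j≢k (trans (sym s≡j) s≡k)

2+n≢n : suc (suc j) ≢ j
2+n≢n e = <⇒≢ (m<n⇒m<1+n (n<1+n _)) (sym e)

adjacent-levels : ∀ {s a b : ℕ} → s ≡ suc a ⊎ s ≡ a → s ≡ suc b ⊎ s ≡ b → b ≡ a ⊎ b ≡ suc a ⊎ suc b ≡ a
adjacent-levels (inj₁ s≡1+a) (inj₁ s≡1+b) = inj₁ (suc-injective (trans (sym s≡1+b) s≡1+a))
adjacent-levels (inj₁ s≡1+a) (inj₂ s≡b)   = inj₂ (inj₁ (trans (sym s≡b) s≡1+a))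
adjacent-levels (inj₂ s≡a)   (inj₁ s≡1+b) = inj₂ (inj₂ (trans (sym s≡1+b) s≡a))
adjacent-levels (inj₂ s≡a)   (inj₂ s≡b)   = inj₁ (trans (sym s≡b) s≡a)

shadowComplement-nonempty : j ≤ n → ShadowComplement {n = n} (suc j) 𝒜 ℬ → ¬ Empty (𝒜 ∪ ℬ)
shadowComplement-nonempty j≤n ℬ-def empty with Level-satisfiable j≤n
... | Y , ∣Y∣ = empty Y (inj₂ (from (ℬ-def Y) (∣Y∣ , λ (_ , A , a , _) → empty A (inj₁ a))))

module _ {n k₀ k₁ : ℕ} {𝒜 ℬ 𝒜″ ℬ″ : Fam n}
  (𝒜-level : 𝒜 ⊆ Level n (suc k₀)) (ℬ-def : ShadowComplement (suc k₀) 𝒜 ℬ)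
  (ℬ″-def : ShadowComplement (suc k₁) 𝒜″ ℬ″) (𝒜″-def : ∀ F → 𝒜″ F ⇔ shadeComplement (suc k₁) ℬ″ F)
  (𝒜ℬ⊆ : (𝒜 ∪ ℬ) ⊆ (𝒜″ ∪ ℬ″)) (⊆levels : (𝒜″ ∪ ℬ″) ⊆ (Level n (suc k₀) ∪ Level n k₀))
  where

  private
    ℬ-level : ℬ ⊆ Level n k₀
    ℬ-level {X} = proj₁ ∘ to (ℬ-def X)
    𝒜″-level : 𝒜″ ⊆ Level n (suc k₁)
    𝒜″-level {X} = proj₁ ∘ to (𝒜″-def X)
    ℬ″-level : ℬ″ ⊆ Level n k₁
    ℬ″-level {X} = proj₁ ∘ to (ℬ″-def X)

  unique-sameLevel : k₁ ≡ k₀ → (𝒜″ ∪ ℬ″) ≐ (shadeComplement (suc k₀) ℬ ∪ ℬ)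
  unique-sameLevel refl = Sum.map 𝒜″⊆𝒜′ ℬ″⊆ℬ , Sum.map 𝒜′⊆𝒜″ ℬ⊆ℬ″
    where
      ℬ⊆ℬ″ : ℬ ⊆ ℬ″
      ℬ⊆ℬ″ b = [ (λ a″ → ⊥-elim (level-clash 1+n≢n (𝒜″-level a″) (ℬ-level b))) , id ]′ (𝒜ℬ⊆ (inj₂ b))
      𝒜⊆𝒜″ : 𝒜 ⊆ 𝒜″
      𝒜⊆𝒜″ a = [ id , (λ b″ → ⊥-elim (level-clash 1+n≢n (𝒜-level a) (ℬ″-level b″))) ]′ (𝒜ℬ⊆ (inj₁ a))
      ℬ″⊆ℬ : ℬ″ ⊆ ℬ
      ℬ″⊆ℬ {Y} b″ = from (ℬ-def Y) (ℬ″-level b″ , proj₂ (to (ℬ″-def Y) b″) ∘ Shadow-mono {k = suc k₀} 𝒜⊆𝒜″)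
      𝒜″⊆𝒜′ : 𝒜″ ⊆ shadeComplement (suc k₀) ℬ
      𝒜″⊆𝒜′ {F} = shadeComplement-antitone ℬ⊆ℬ″ ∘ to (𝒜″-def F)
      𝒜′⊆𝒜″ : shadeComplement (suc k₀) ℬ ⊆ 𝒜″
      𝒜′⊆𝒜″ {F} = from (𝒜″-def F) ∘ shadeComplement-antitone ℬ″⊆ℬ

  unique-levelAbove : k₁ ≡ suc k₀ → (𝒜″ ∪ ℬ″) ≐ (shadeComplement (suc k₀) ℬ ∪ ℬ)
  unique-levelAbove refl =
      [ ⊥-elim ∘ 𝒜″-empty , (λ b″ → inj₁ (ℬ″-level b″ , λ (_ , _ , b , _) → ℬ-empty b)) ]′
    , [ (λ (∣F∣ , _) → inj₂ (from (ℬ″-def _) (∣F∣ , λ (_ , _ , a″ , _) → 𝒜″-empty a″))) , ⊥-elim ∘ ℬ-empty ]′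
    where
      𝒜″-empty : ∀ {X} → ¬ 𝒜″ X
      𝒜″-empty a″ = [ level-clash 1+n≢n (𝒜″-level a″) , level-clash 2+n≢n (𝒜″-level a″) ]′ (⊆levels (inj₁ a″))
      ℬ-empty : ∀ {X} → ¬ ℬ X
      ℬ-empty b = [ 𝒜″-empty , (λ b″ → level-clash 1+n≢n (ℬ″-level b″) (ℬ-level b)) ]′ (𝒜ℬ⊆ (inj₂ b))

  unique-levelBelow : suc k₁ ≡ k₀ → (𝒜″ ∪ ℬ″) ≐ (shadeComplement (suc k₀) ℬ ∪ ℬ)
  unique-levelBelow refl =
      [ (λ a″ → inj₂ (from (ℬ-def _) (𝒜″-level a″ , λ (_ , _ , a , _) → 𝒜-empty a))) , ⊥-elim ∘ ℬ″-empty ]′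
    , [ (λ (∣F∣ , F∉∇ℬ) → ⊥-elim (F∉∇ℬ (∇ℬ-full ∣F∣)))
      , (λ b → inj₁ (from (𝒜″-def _) (ℬ-level b , λ (_ , _ , b″ , _) → ℬ″-empty b″))) ]′
    where
      ℬ″-empty : ∀ {X} → ¬ ℬ″ X
      ℬ″-empty b″ = [ level-clash (2+n≢n ∘ sym) (ℬ″-level b″) , level-clash (1+n≢n ∘ sym) (ℬ″-level b″) ]′
                      (⊆levels (inj₂ b″))
      𝒜-empty : ∀ {X} → ¬ 𝒜 X
      𝒜-empty a = [ (λ a″ → level-clash 1+n≢n (𝒜-level a) (𝒜″-level a″)) , ℬ″-empty ]′ (𝒜ℬ⊆ (inj₁ a))
      ∇ℬ-full : ∀ {F} → ∣ F ∣ ≡ suc (suc k₁) → Shade (suc k₁) ℬ F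
      ∇ℬ-full ∣F∣ with ∃-⋖ ∣F∣
      ... | Y , Y⋖F = ∣F∣ , Y , Y∈ℬ , ⋖⇒⊂ Y⋖F
        where
          Y∈ℬ : ℬ Y
          Y∈ℬ = from (ℬ-def Y) (suc-injective (trans (sym (⋖-size Y⋖F)) ∣F∣) , λ (_ , _ , a , _) → 𝒜-empty a)

  -- Constructively we only know that 𝒜 ∪ ℬ is not empty; this suffices as the conclusion is decidable.
  levels-adjacent : k₀ ≤ n → k₁ ≡ k₀ ⊎ k₁ ≡ suc k₀ ⊎ suc k₁ ≡ k₀
  levels-adjacent k₀≤n = decidable-stable (k₁ ≟ k₀ ⊎-dec k₁ ≟ suc k₀ ⊎-dec suc k₁ ≟ k₀) λ not-adjacent →
    shadowComplement-nonempty k₀≤n ℬ-def λ X X∈𝒜∪ℬ →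
      not-adjacent (adjacent-levels (Sum.map 𝒜-level ℬ-level X∈𝒜∪ℬ) (Sum.map 𝒜″-level ℬ″-level (𝒜ℬ⊆ X∈𝒜∪ℬ)))

  maximal-unique : k₀ ≤ n → (𝒜″ ∪ ℬ″) ≐ (shadeComplement (suc k₀) ℬ ∪ ℬ)
  maximal-unique k₀≤n = [ unique-sameLevel , [ unique-levelAbove , unique-levelBelow ]′ ]′ (levels-adjacent k₀≤n)

proposition6 : (n k m : ℕ) (𝒜 ℬ : Fam n) → 2 ≤ k → k ≤ n → FSFA n k m 𝒜 ℬ →
    Σ (Fam n) λ 𝒜′ →
      (∃ λ m′ → MSFA n k m′ 𝒜′ ℬ)
      × 𝒜 ⊆ 𝒜′ × 𝒜′ ⊆ Level n k
      × (∀ k″ m″ (𝒜″ ℬ″ : Fam n) → MSFA n k″ m″ 𝒜″ ℬ″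
          → (𝒜 ∪ ℬ) ⊆ (𝒜″ ∪ ℬ″)
          → (𝒜″ ∪ ℬ″) ⊆ (Level n k ∪ Level n (k ∸ 1))
          → (𝒜″ ∪ ℬ″) ≐ (𝒜′ ∪ ℬ))
proposition6 n (suc k₀) m 𝒜 ℬ (s≤s _) k≤n fsfa@(_ , _ , _ , first , ℬ-def) =
  shadeComplement (suc k₀) ℬ , shadeComplement-MSFA fsfa , ⊆-shadeComplement 𝒜-level ℬ-def , proj₁ , unique
  where
    𝒜-level : 𝒜 ⊆ Level n (suc k₀)
    𝒜-level = firstInSquashed-level first
    unique : ∀ k″ m″ (𝒜″ ℬ″ : Fam n) → MSFA n k″ m″ 𝒜″ ℬ″
      → (𝒜 ∪ ℬ) ⊆ (𝒜″ ∪ ℬ″)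
      → (𝒜″ ∪ ℬ″) ⊆ (Level n (suc k₀) ∪ Level n k₀)
      → (𝒜″ ∪ ℬ″) ≐ (shadeComplement (suc k₀) ℬ ∪ ℬ)
    unique zero     _ _ _ ((() , _) , _)
    unique (suc k₁) _ _ _ ((_ , _ , _ , _ , ℬ″-def) , 𝒜″-def) 𝒜ℬ⊆ ⊆levels =
      maximal-unique 𝒜-level ℬ-def ℬ″-def 𝒜″-def 𝒜ℬ⊆ ⊆levels (<⇒≤ k≤n)
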